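{- Let $G_1$ and $G_2$ be non-complete graphs on disjoint vertex sets. Then \[\varsigma_c(G_1\vee G_2)\ge\min\{|V(G_1)|+\varsigma(G_2),\ |V(G_2)|+\varsigma(G_1),\ \theta(G_1)+\theta(G_2)\}.\] Furthermore, if both $G_1$ and $G_2$ are disconnected, then \[\varsigma_c(G_1\vee G_2)\ge\min\{|V(G_1)|+\max\{\varsigma(G_2),1\},\ |V(G_2)|+\max\{\varsigma(G_1),1\},\ \theta(G_1)+\theta(G_2)\}.\]
   Context: Graphs are finite, simple, undirected. $G_1\vee G_2$ is the join: the disjoint union plus all edges between $V(G_1)$ and $V(G_2)$. $\varsigma(G)$ is the minimum size of a set $S\subseteq V(G)$ such that every component of $G-S$ is a clique; $\varsigma_c(G)$ is the minimum size of such a set with $G[S]$ additionally connected ($\infty$ if none exists). $\theta(G)$ is the minimum size of a set $S$ with $G-S$ a clique. -}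

module Defs where

open import Data.Nat using (ℕ; _+_)
open import Data.Bool using (Bool; true; false)
open import Data.Fin using (Fin; splitAt)
open import Data.Fin.Subset using (Subset; inside; outside; ∣_∣; ⊤)
open import Data.Vec using (lookup)
open import Data.Sum using (_⊎_; inj₁; inj₂)
open import Data.Product using (Σ; _×_; _,_; ∃)
open import Relation.Nullary using (¬_)
open import Relation.Binary.PropositionalEquality using (_≡_; _≢_; refl)

record Graph (n : ℕ) : Set where
  field
    adj    : Fin n → Fin n → Bool
    sym    : ∀ u v → adj u v ≡ adj v u
    irrefl : ∀ u → adj u u ≡ false
open Graph public

Adj : ∀ {n} → Graph n → Fin n → Fin n → Set
Adj G u v = adj G u v ≡ true

In : ∀ {n} → Subset n → Fin n → Set
In T u = lookup T u ≡ inside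

compl : ∀ {n} → Subset n → Subset n
compl = Data.Fin.Subset.∁

-- Reach G T u v : there is a walk from u to v in the induced subgraph G[T]
data Reach {n} (G : Graph n) (T : Subset n) : Fin n → Fin n → Set where
  here : ∀ {u} → In T u → Reach G T u u
  step : ∀ {u v w} → In T u → Adj G u v → Reach G T v w → Reach G T u w

ConnectedOn : ∀ {n} → Graph n → Subset n → Set
ConnectedOn G T = ∀ u v → In T u → In T v → Reach G T u v

CliqueOn : ∀ {n} → Graph n → Subset n → Set
CliqueOn G T = ∀ u v → In T u → In T v → u ≢ v → Adj G u v

-- every component of G[T] is a clique
ComponentsCliques : ∀ {n} → Graph n → Subset n → Set
ComponentsCliques G T = ∀ u v → Reach G T u v → u ≢ v → Adj G u v

IsCliqueCut : ∀ {n} → Graph n → Subset n → Set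
IsCliqueCut G S = ComponentsCliques G (compl S)

IsConnCliqueCut : ∀ {n} → Graph n → Subset n → Set
IsConnCliqueCut G S = IsCliqueCut G S × ConnectedOn G S

IsCliqueDeletion : ∀ {n} → Graph n → Subset n → Set
IsCliqueDeletion G S = CliqueOn G (compl S)

IsMinSize : ∀ {n} → (Subset n → Set) → ℕ → Set
IsMinSize {n} P k = Σ (Subset n) (λ S → P S × ∣ S ∣ ≡ k) × (∀ S → P S → k Data.Nat.≤ ∣ S ∣)

IsVarsigma : ∀ {n} → Graph n → ℕ → Set
IsVarsigma G = IsMinSize (IsCliqueCut G)

IsTheta : ∀ {n} → Graph n → ℕ → Set
IsTheta G = IsMinSize (IsCliqueDeletion G)

NonComplete : ∀ {n} → Graph n → Set
NonComplete G = ∃ λ u → ∃ λ v → u ≢ v × adj G u v ≡ false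

Disconnected : ∀ {n} → Graph n → Set
Disconnected G = ¬ ConnectedOn G ⊤

-- Join of G1 (on Fin m) and G2 (on Fin n), vertex set Fin (m + n):
-- the first m vertices are G1's, the last n are G2's.
module _ {m n : ℕ} (G₁ : Graph m) (G₂ : Graph n) where
  joinAdj : Fin m ⊎ Fin n → Fin m ⊎ Fin n → Bool
  joinAdj (inj₁ a) (inj₁ b) = adj G₁ a b
  joinAdj (inj₂ a) (inj₂ b) = adj G₂ a b
  joinAdj (inj₁ _) (inj₂ _) = true
  joinAdj (inj₂ _) (inj₁ _) = true

  joinAdj-sym : ∀ x y → joinAdj x y ≡ joinAdj y x
  joinAdj-sym (inj₁ a) (inj₁ b) = sym G₁ a b
  joinAdj-sym (inj₂ a) (inj₂ b) = sym G₂ a b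
  joinAdj-sym (inj₁ _) (inj₂ _) = refl
  joinAdj-sym (inj₂ _) (inj₁ _) = refl

  joinAdj-irrefl : ∀ x → joinAdj x x ≡ false
  joinAdj-irrefl (inj₁ a) = irrefl G₁ a
  joinAdj-irrefl (inj₂ a) = irrefl G₂ a

  join : Graph (m + n)
  join = record
    { adj = λ u v → joinAdj (splitAt m u) (splitAt m v)
    ; sym = λ u v → joinAdj-sym (splitAt m u) (splitAt m v)
    ; irrefl = λ u → joinAdj-irrefl (splitAt m u)
    }

{-# OPTIONS --safe #-}
module Submission where

-- Write a connected clique-cut S of G₁ ∨ G₂ as S₁ ++ S₂. If S₁ is all of V(G₁), then S₂ is a
-- clique-cut of G₂, so |S| ≥ |V(G₁)| + ς(G₂); if G₁ is disconnected, S₂ cannot be empty, as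
-- otherwise (G₁ ∨ G₂)[S] = G₁ would be connected. The case S₂ = V(G₂) is symmetric. Otherwise some
-- b ∉ S₂ survives and is adjacent to every vertex of G₁ - S₁, which therefore lies in a single
-- component of the join minus S and is a clique; likewise for G₂ - S₂, so |S| ≥ θ(G₁) + θ(G₂).

open import Defs
open import Data.Bool using (not)
open import Data.Empty using (⊥-elim)
open import Data.Fin using (Fin; _↑ˡ_; _↑ʳ_; splitAt)
open import Data.Fin.Properties
  using (splitAt-↑ˡ; splitAt-↑ʳ; splitAt⁻¹-↑ˡ; splitAt⁻¹-↑ʳ; ↑ˡ-injective; ↑ʳ-injective)
open import Data.Fin.Subset using (Subset; inside; outside; ⊤; ⊥; ∁; ∣_∣)
open import Data.Fin.Subset.Properties
  using (nonempty?; Empty-unique; ⊆⊤; ⊆-antisym; x∉∁p⇒x∈p; x∈p⇒∣p-x∣<∣p∣; ∣⊤∣≡n)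
open import Data.Nat using (ℕ; suc; _+_; _≤_; _⊓_; _⊔_; z≤n; s≤s)
open import Data.Nat.Properties
  using (≤-trans; ≤-reflexive; +-comm; +-mono-≤; ⊔-lub; m≤n⇒m⊓o≤n; m≤n⇒o⊓m≤n)
open import Data.Product using (∃; _×_; _,_)
open import Data.Sum using (_⊎_; inj₁; inj₂)
open import Data.Vec using ([]; _∷_; _++_; lookup)
import Data.Vec as Vec
open import Data.Vec.Properties using (lookup-++ˡ; lookup-++ʳ; lookup-map; lookup-replicate; []=⇒lookup)
open import Relation.Nullary using (yes; no; contradiction)
open import Relation.Binary.PropositionalEquality as ≡ using (_≡_; _≢_; refl; trans; cong; cong₂)
open ≡.≡-Reasoning

∣p++q∣≡∣p∣+∣q∣ : ∀ {m n} (p : Subset m) (q : Subset n) → ∣ p ++ q ∣ ≡ ∣ p ∣ + ∣ q ∣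
∣p++q∣≡∣p∣+∣q∣ []            q = refl
∣p++q∣≡∣p∣+∣q∣ (inside  ∷ p) q = cong suc (∣p++q∣≡∣p∣+∣q∣ p q)
∣p++q∣≡∣p∣+∣q∣ (outside ∷ p) q = ∣p++q∣≡∣p∣+∣q∣ p q

p≡⊤⊎∃∈∁p : ∀ {n} (p : Subset n) → p ≡ ⊤ ⊎ ∃ λ x → In (∁ p) x
p≡⊤⊎∃∈∁p p with nonempty? (∁ p)
... | yes (x , x∈∁p) = inj₂ (x , []=⇒lookup x∈∁p)
... | no  ∁p-empty   = inj₁ (⊆-antisym ⊆⊤ λ _ → x∉∁p⇒x∈p λ x∈∁p → ∁p-empty (_ , x∈∁p))

p≡⊥⊎1≤∣p∣ : ∀ {n} (p : Subset n) → p ≡ ⊥ ⊎ 1 ≤ ∣ p ∣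
p≡⊥⊎1≤∣p∣ p with nonempty? p
... | yes (x , x∈p) = inj₂ (≤-trans (s≤s z≤n) (x∈p⇒∣p-x∣<∣p∣ x∈p))
... | no  p-empty   = inj₁ (Empty-unique p-empty)

++-elim : ∀ {m n} {P : Subset (m + n) → Set} → (∀ p q → P (p ++ q)) → ∀ S → P S
++-elim {m} h S with Vec.splitAt m S
... | p , q , refl = h p q

reach-source : ∀ {k} {H : Graph k} {T u v} → Reach H T u v → In T u
reach-source (here u∈T)     = u∈T
reach-source (step u∈T _ _) = u∈T

componentsCliques-common-neighbour : ∀ {k} {H : Graph k} {T} → ComponentsCliques H T →
  ∀ {u v w} → In T u → In T v → In T w → Adj H u w → Adj H w v → u ≢ v → Adj H u v
componentsCliques-common-neighbour cc u∈T v∈T w∈T uw wv =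
  cc _ _ (step u∈T uw (step w∈T wv (here v∈T)))

record InducedEmbedding {a k} (G : Graph a) (H : Graph k) : Set where
  field
    embed           : Fin a → Fin k
    embed-injective : ∀ {u v} → embed u ≡ embed v → u ≡ v
    adj-embed       : ∀ u v → adj H (embed u) (embed v) ≡ adj G u v

module _ {a k} {G : Graph a} {H : Graph k} (e : InducedEmbedding G H) where
  open InducedEmbedding e

  record IsPreimage (T : Subset k) (T′ : Subset a) : Set where
    constructor preimage
    field lookup-embed : ∀ u → lookup T (embed u) ≡ lookup T′ u
  open IsPreimage public

  ImageCovers : Subset k → Set
  ImageCovers T = ∀ {x} → In T x → ∃ λ u → embed u ≡ x

  IsPreimage-∁ : ∀ {T T′} → IsPreimage T T′ → IsPreimage (∁ T) (∁ T′)
  IsPreimage-∁ {T} {T′} pre = preimage λ u → begin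
    lookup (∁ T) (embed u)   ≡⟨ lookup-map (embed u) not T ⟩
    not (lookup T (embed u)) ≡⟨ cong not (lookup-embed pre u) ⟩
    not (lookup T′ u)        ≡⟨ lookup-map u not T′ ⟨
    lookup (∁ T′) u          ∎

  module _ {T : Subset k} {T′ : Subset a} (pre : IsPreimage T T′) where

    reach-embed : ∀ {u v} → Reach G T′ u v → Reach H T (embed u) (embed v)
    reach-embed (here u∈T′)      = here (trans (lookup-embed pre _) u∈T′)
    reach-embed (step u∈T′ uw r) =
      step (trans (lookup-embed pre _) u∈T′) (trans (adj-embed _ _) uw) (reach-embed r)

    reach-unembed : ImageCovers T → ∀ {u v} → Reach H T (embed u) (embed v) → Reach G T′ u v
    reach-unembed covers r = unembed r refl refl
      where
      unembed : ∀ {x y u v} → Reach H T x y → embed u ≡ x → embed v ≡ y → Reach G T′ u v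
      unembed (here x∈T) refl eq with refl ← embed-injective eq =
        here (trans (≡.sym (lookup-embed pre _)) x∈T)
      unembed (step x∈T xy r) refl refl with w , refl ← covers (reach-source r) =
        step (trans (≡.sym (lookup-embed pre _)) x∈T) (trans (≡.sym (adj-embed _ _)) xy)
          (unembed r refl refl)

    componentsCliques-pullback : ComponentsCliques H T → ComponentsCliques G T′
    componentsCliques-pullback cc u v r u≢v =
      trans (≡.sym (adj-embed u v)) (cc _ _ (reach-embed r) λ eq → u≢v (embed-injective eq))

    connectedOn-pullback : ImageCovers T → ConnectedOn H T → ConnectedOn G T′
    connectedOn-pullback covers conn u v u∈T′ v∈T′ =
      reach-unembed covers
        (conn _ _ (trans (lookup-embed pre u) u∈T′) (trans (lookup-embed pre v) v∈T′))

    cliqueOn-pullback-common-neighbour : ComponentsCliques H T →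
      ∀ {w} → In T w → (∀ u → Adj H (embed u) w) → CliqueOn G T′
    cliqueOn-pullback-common-neighbour cc w∈T uw u v u∈T′ v∈T′ u≢v =
      trans (≡.sym (adj-embed u v))
        (componentsCliques-common-neighbour cc
          (trans (lookup-embed pre u) u∈T′) (trans (lookup-embed pre v) v∈T′) w∈T
          (uw u) (trans (sym H _ _) (uw v)) λ eq → u≢v (embed-injective eq))

module _ {m n} (G₁ : Graph m) (G₂ : Graph n) where

  join-adj-↑ˡ-↑ʳ : ∀ u v → Adj (join G₁ G₂) (u ↑ˡ n) (m ↑ʳ v)
  join-adj-↑ˡ-↑ʳ u v = cong₂ (joinAdj G₁ G₂) (splitAt-↑ˡ m u n) (splitAt-↑ʳ m n v)

  join-adj-↑ʳ-↑ˡ : ∀ v u → Adj (join G₁ G₂) (m ↑ʳ v) (u ↑ˡ n)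
  join-adj-↑ʳ-↑ˡ v u = cong₂ (joinAdj G₁ G₂) (splitAt-↑ʳ m n v) (splitAt-↑ˡ m u n)

  join-embedˡ : InducedEmbedding G₁ (join G₁ G₂)
  join-embedˡ = record
    { embed           = _↑ˡ n
    ; embed-injective = ↑ˡ-injective n _ _
    ; adj-embed       = λ u v → cong₂ (joinAdj G₁ G₂) (splitAt-↑ˡ m u n) (splitAt-↑ˡ m v n)
    }

  join-embedʳ : InducedEmbedding G₂ (join G₁ G₂)
  join-embedʳ = record
    { embed           = m ↑ʳ_
    ; embed-injective = ↑ʳ-injective m _ _
    ; adj-embed       = λ u v → cong₂ (joinAdj G₁ G₂) (splitAt-↑ʳ m n u) (splitAt-↑ʳ m n v)
    }

  ++-preimageˡ : ∀ (p : Subset m) (q : Subset n) → IsPreimage join-embedˡ (p ++ q) p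
  ++-preimageˡ p q = preimage (lookup-++ˡ p q)

  ++-preimageʳ : ∀ (p : Subset m) (q : Subset n) → IsPreimage join-embedʳ (p ++ q) q
  ++-preimageʳ p q = preimage (lookup-++ʳ p q)

  ∁++-preimageˡ : ∀ (p : Subset m) (q : Subset n) → IsPreimage join-embedˡ (∁ (p ++ q)) (∁ p)
  ∁++-preimageˡ p q = IsPreimage-∁ join-embedˡ (++-preimageˡ p q)

  ∁++-preimageʳ : ∀ (p : Subset m) (q : Subset n) → IsPreimage join-embedʳ (∁ (p ++ q)) (∁ q)
  ∁++-preimageʳ p q = IsPreimage-∁ join-embedʳ (++-preimageʳ p q)

  ++⊥-coveredˡ : ∀ (p : Subset m) → ImageCovers join-embedˡ (p ++ ⊥)
  ++⊥-coveredˡ p {x} x∈p++⊥ with splitAt m x in eq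
  ... | inj₁ u = u , splitAt⁻¹-↑ˡ eq
  ... | inj₂ v = contradiction (begin
    outside                  ≡⟨ lookup-replicate v outside ⟨
    lookup ⊥ v               ≡⟨ lookup-++ʳ p ⊥ v ⟨
    lookup (p ++ ⊥) (m ↑ʳ v) ≡⟨ cong (lookup (p ++ ⊥)) (splitAt⁻¹-↑ʳ eq) ⟩
    lookup (p ++ ⊥) x        ≡⟨ x∈p++⊥ ⟩
    inside                   ∎) λ ()

  ⊥++-coveredʳ : ∀ (q : Subset n) → ImageCovers join-embedʳ (⊥ ++ q)
  ⊥++-coveredʳ q {x} x∈⊥++q with splitAt m x in eq
  ... | inj₂ v = v , splitAt⁻¹-↑ʳ eq
  ... | inj₁ u = contradiction (begin
    outside                  ≡⟨ lookup-replicate u outside ⟨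
    lookup ⊥ u               ≡⟨ lookup-++ˡ ⊥ q u ⟨
    lookup (⊥ ++ q) (u ↑ˡ n) ≡⟨ cong (lookup (⊥ ++ q)) (splitAt⁻¹-↑ˡ eq) ⟩
    lookup (⊥ ++ q) x        ≡⟨ x∈⊥++q ⟩
    inside                   ∎) λ ()

  module _ (S₁ : Subset m) (S₂ : Subset n) (cut : IsCliqueCut (join G₁ G₂) (S₁ ++ S₂)) where

    join-cliqueCutˡ : IsCliqueCut G₁ S₁
    join-cliqueCutˡ = componentsCliques-pullback join-embedˡ (∁++-preimageˡ S₁ S₂) cut

    join-cliqueCutʳ : IsCliqueCut G₂ S₂
    join-cliqueCutʳ = componentsCliques-pullback join-embedʳ (∁++-preimageʳ S₁ S₂) cut

    join-cliqueDeletionˡ : ∀ {b} → In (∁ S₂) b → IsCliqueDeletion G₁ S₁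
    join-cliqueDeletionˡ {b} b∉S₂ =
      cliqueOn-pullback-common-neighbour join-embedˡ (∁++-preimageˡ S₁ S₂) cut
        (trans (lookup-embed (∁++-preimageʳ S₁ S₂) b) b∉S₂) λ u → join-adj-↑ˡ-↑ʳ u b

    join-cliqueDeletionʳ : ∀ {a} → In (∁ S₁) a → IsCliqueDeletion G₂ S₂
    join-cliqueDeletionʳ {a} a∉S₁ =
      cliqueOn-pullback-common-neighbour join-embedʳ (∁++-preimageʳ S₁ S₂) cut
        (trans (lookup-embed (∁++-preimageˡ S₁ S₂) a) a∉S₁) λ v → join-adj-↑ʳ-↑ˡ v a

    join-cliqueCut-cases : S₁ ≡ ⊤ ⊎ S₂ ≡ ⊤ ⊎ (IsCliqueDeletion G₁ S₁ × IsCliqueDeletion G₂ S₂)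
    join-cliqueCut-cases with p≡⊤⊎∃∈∁p S₁ | p≡⊤⊎∃∈∁p S₂
    ... | inj₁ S₁≡⊤       | _               = inj₁ S₁≡⊤
    ... | inj₂ _          | inj₁ S₂≡⊤       = inj₂ (inj₁ S₂≡⊤)
    ... | inj₂ (a , a∉S₁) | inj₂ (b , b∉S₂) =
      inj₂ (inj₂ (join-cliqueDeletionˡ b∉S₂ , join-cliqueDeletionʳ a∉S₁))

    join-cliqueCut-size : ∀ {k₁ k₂ t₁ t₂} →
      (∀ S → IsCliqueDeletion G₁ S → t₁ ≤ ∣ S ∣) → (∀ S → IsCliqueDeletion G₂ S → t₂ ≤ ∣ S ∣) →
      (S₂ ≡ ⊤ → k₁ ≤ ∣ S₁ ∣) → (S₁ ≡ ⊤ → k₂ ≤ ∣ S₂ ∣) →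
      (m + k₂) ⊓ ((n + k₁) ⊓ (t₁ + t₂)) ≤ ∣ S₁ ++ S₂ ∣
    join-cliqueCut-size {k₁} θ₁ θ₂ k₁≤ k₂≤
      rewrite ∣p++q∣≡∣p∣+∣q∣ S₁ S₂ with join-cliqueCut-cases
    ... | inj₁ refl =
      m≤n⇒m⊓o≤n _ (+-mono-≤ (≤-reflexive (≡.sym (∣⊤∣≡n m))) (k₂≤ refl))
    ... | inj₂ (inj₁ refl) =
      m≤n⇒o⊓m≤n _ (m≤n⇒m⊓o≤n _ (≤-trans (≤-reflexive (+-comm n k₁))
        (+-mono-≤ (k₁≤ refl) (≤-reflexive (≡.sym (∣⊤∣≡n n))))))
    ... | inj₂ (inj₂ (del₁ , del₂)) =
      m≤n⇒o⊓m≤n _ (m≤n⇒o⊓m≤n _ (+-mono-≤ (θ₁ S₁ del₁) (θ₂ S₂ del₂)))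

  join-connectedˡ : ConnectedOn (join G₁ G₂) (⊤ {m} ++ ⊥ {n}) → ConnectedOn G₁ ⊤
  join-connectedˡ = connectedOn-pullback join-embedˡ (++-preimageˡ ⊤ ⊥) (++⊥-coveredˡ ⊤)

  join-connectedʳ : ConnectedOn (join G₁ G₂) (⊥ {m} ++ ⊤ {n}) → ConnectedOn G₂ ⊤
  join-connectedʳ = connectedOn-pullback join-embedʳ (++-preimageʳ ⊥ ⊤) (⊥++-coveredʳ ⊤)

  join-connected-1≤ʳ : ∀ (S₁ : Subset m) (S₂ : Subset n) →
    Disconnected G₁ → ConnectedOn (join G₁ G₂) (S₁ ++ S₂) → S₁ ≡ ⊤ → 1 ≤ ∣ S₂ ∣
  join-connected-1≤ʳ _ S₂ disc conn refl with p≡⊥⊎1≤∣p∣ S₂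
  ... | inj₁ refl    = ⊥-elim (disc (join-connectedˡ conn))
  ... | inj₂ 1≤∣S₂∣ = 1≤∣S₂∣

  join-connected-1≤ˡ : ∀ (S₁ : Subset m) (S₂ : Subset n) →
    Disconnected G₂ → ConnectedOn (join G₁ G₂) (S₁ ++ S₂) → S₂ ≡ ⊤ → 1 ≤ ∣ S₁ ∣
  join-connected-1≤ˡ S₁ _ disc conn refl with p≡⊥⊎1≤∣p∣ S₁
  ... | inj₁ refl    = ⊥-elim (disc (join-connectedʳ conn))
  ... | inj₂ 1≤∣S₁∣ = 1≤∣S₁∣

lemma25 : ∀ {m n : ℕ} (G₁ : Graph m) (G₂ : Graph n) →
    NonComplete G₁ → NonComplete G₂ →
    ∀ (s₁ s₂ t₁ t₂ : ℕ) →
    IsVarsigma G₁ s₁ → IsVarsigma G₂ s₂ → IsTheta G₁ t₁ → IsTheta G₂ t₂ →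
    (∀ S → IsConnCliqueCut (join G₁ G₂) S →
       (m + s₂) ⊓ ((n + s₁) ⊓ (t₁ + t₂)) ≤ ∣ S ∣)
    ×
    (Disconnected G₁ → Disconnected G₂ →
     ∀ S → IsConnCliqueCut (join G₁ G₂) S →
       (m + (s₂ ⊔ 1)) ⊓ ((n + (s₁ ⊔ 1)) ⊓ (t₁ + t₂)) ≤ ∣ S ∣)
lemma25 {m} {n} G₁ G₂ _ _ s₁ s₂ t₁ t₂ (_ , ς₁) (_ , ς₂) (_ , θ₁) (_ , θ₂) =
  ++-elim bound , λ disc₁ disc₂ → ++-elim (bound-disconnected disc₁ disc₂)
  where
  bound : ∀ S₁ S₂ → IsConnCliqueCut (join G₁ G₂) (S₁ ++ S₂) →
    (m + s₂) ⊓ ((n + s₁) ⊓ (t₁ + t₂)) ≤ ∣ S₁ ++ S₂ ∣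
  bound S₁ S₂ (cut , _) = join-cliqueCut-size G₁ G₂ S₁ S₂ cut θ₁ θ₂
    (λ _ → ς₁ S₁ (join-cliqueCutˡ G₁ G₂ S₁ S₂ cut))
    (λ _ → ς₂ S₂ (join-cliqueCutʳ G₁ G₂ S₁ S₂ cut))

  bound-disconnected : Disconnected G₁ → Disconnected G₂ →
    ∀ S₁ S₂ → IsConnCliqueCut (join G₁ G₂) (S₁ ++ S₂) →
    (m + (s₂ ⊔ 1)) ⊓ ((n + (s₁ ⊔ 1)) ⊓ (t₁ + t₂)) ≤ ∣ S₁ ++ S₂ ∣
  bound-disconnected disc₁ disc₂ S₁ S₂ (cut , conn) = join-cliqueCut-size G₁ G₂ S₁ S₂ cut θ₁ θ₂
    (λ S₂≡⊤ → ⊔-lub (ς₁ S₁ (join-cliqueCutˡ G₁ G₂ S₁ S₂ cut))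
                    (join-connected-1≤ˡ G₁ G₂ S₁ S₂ disc₂ conn S₂≡⊤))
    (λ S₁≡⊤ → ⊔-lub (ς₂ S₂ (join-cliqueCutʳ G₁ G₂ S₁ S₂ cut))
                    (join-connected-1≤ʳ G₁ G₂ S₁ S₂ disc₁ conn S₁≡⊤))
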